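{- Let $A$ be a finite set with $k\ge 2$ elements. The Euler characteristic of the complex $\Omega(A)$ equals $1-(-1)^k(k-1)!$.
   Context: $\nabla(A)$ is the simplex with $2^{k-1}-1$ vertices, in one-to-one correspondence with the unordered partitions of $A$ into two nonempty subsets. A face of $\nabla(A)$ is called non-complete if there exist two elements $a,b\in A$ such that for every vertex of the face, $a$ and $b$ lie in the same part of the corresponding partition. $\Omega(A)$ is the simplicial complex of all nonempty non-complete faces of $\nabla(A)$ (its Euler characteristic is the usual, unreduced one). -}

module Defs where

open import Data.Nat using (ℕ; zero; suc; _∸_)
open import Data.Integer using (ℤ; +_; -_; _+_)
open import Data.Bool using (Bool; true; false; _∧_; not)
import Data.Bool.Properties as BoolP
open import Data.Vec using (Vec; []; _∷_; lookup)
open import Data.List using (List; []; _∷_; [_]; _++_; map; filter; length; foldr)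
open import Data.List.Relation.Unary.All using (All; all?)
open import Data.Fin using (Fin; _≟_)
open import Data.Fin.Properties using (any?)
open import Data.Product using (∃; Σ; _×_; _,_)
open import Relation.Binary.PropositionalEquality using (_≡_; _≢_; refl)
open import Relation.Nullary using (Dec; yes; no; ¬_; ¬?)
open import Relation.Nullary.Decidable using (_×-dec_)

Colouring : ℕ → Set
Colouring k = Vec Bool k

colourings : (k : ℕ) → List (Colouring k)
colourings zero = [ [] ]
colourings (suc k) = map (true ∷_) (colourings k) ++ map (false ∷_) (colourings k)

-- An unordered partition {S, A∖S} of A = Fin k into two nonempty parts is
-- represented canonically by the part S containing the element 0:
-- the colouring is true at 0 and takes the value false somewhere.
someFalse : {k : ℕ} → Colouring k → Bool
someFalse [] = false
someFalse (b ∷ v) = not b Data.Bool.∨ someFalse v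

isVertex : {k : ℕ} → Colouring k → Bool
isVertex [] = false
isVertex (b ∷ v) = b ∧ someFalse v

-- The vertices of ∇(A): the 2^(k-1) - 1 unordered two-block partitions.
vertices : (k : ℕ) → List (Colouring k)
vertices k = filter (λ p → isVertex p BoolP.≟ true) (colourings k)

sublists : {X : Set} → List X → List (List X)
sublists [] = [ [] ]
sublists (x ∷ xs) = sublists xs ++ map (x ∷_) (sublists xs)

NonEmpty : {X : Set} → List X → Set
NonEmpty xs = ¬ (xs ≡ [])

nonEmpty? : {X : Set} → (xs : List X) → Dec (NonEmpty xs)
nonEmpty? [] = no (λ ne → ne refl)
nonEmpty? (x ∷ xs) = yes (λ ())

faces : (k : ℕ) → List (List (Colouring k))
faces k = filter nonEmpty? (sublists (vertices k))

NonComplete : {k : ℕ} → List (Colouring k) → Set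
NonComplete {k} F = ∃ λ (a : Fin k) → ∃ λ (b : Fin k) →
  a ≢ b × All (λ p → lookup p a ≡ lookup p b) F

nonComplete? : {k : ℕ} → (F : List (Colouring k)) → Dec (NonComplete F)
nonComplete? F = any? (λ a → any? (λ b →
  ¬? (a ≟ b) ×-dec all? (λ p → lookup p a BoolP.≟ lookup p b) F))

Ω : (k : ℕ) → List (List (Colouring k))
Ω k = filter nonComplete? (faces k)

sign : ℕ → ℤ
sign zero = + 1
sign (suc n) = - sign n

-- Unreduced Euler characteristic: Σ over faces F of (-1)^(dim F),
-- where dim F = |F| - 1.
eulerChar : {X : Set} → List (List X) → ℤ
eulerChar = foldr (λ F acc → sign (length F ∸ 1) + acc) (+ 0)

_ : eulerChar (Ω 2) ≡ + 0
_ = refl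
_ : eulerChar (Ω 3) ≡ + 3
_ = refl
_ : eulerChar (Ω 4) ≡ - (+ 5)
_ = refl

module Submission where

-- Since ∇(A) is a simplex, χ(Ω) = 1 − Σ (−1)^(|F|−1) over the nonempty faces F separating every
-- pair of points. Fixing the part containing 0, such a face on k+1 points is a set T of colourings
-- of the other k points, not all true; with ψ(k) = Σ_T [T separates] (−1)^|T| (separatingSum k)
-- this gives χ(Ω) = 1 + ψ(k−1). A face on one more point is T₁ ∪ T₂, the new point being coloured
-- true on T₁ and false on T₂. It separates iff T₁ ∪ T₂ does and no old point c is coloured like the
-- new one throughout. Pairing T₂ with T₂ ∪ {all true} cancels the first term, and for each of the
-- k+1 points c the pairs (T₁, T₂) in which c copies the new point correspond bijectively to sets T.
-- Hence ψ(k+1) = −(k+1) ψ(k), and ψ(k) = (−1)^k k!.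

open import Defs
open import Data.Nat using (ℕ; _≤_; _∸_; _!)
open import Data.Integer using (ℤ; +_; _-_; _*_)
open import Relation.Binary.PropositionalEquality using (_≡_)

open import Data.Nat using (zero; suc; s≤s; z≤n)
import Data.Nat as ℕ
open import Data.Integer using (-_; _+_)
import Data.Integer.Properties as ℤ
open import Data.Integer.Tactic.RingSolver using (solve-∀)
open import Data.Bool using (Bool; true; false)
import Data.Bool.Properties as Bool
open import Data.Vec using (Vec; []; _∷_; lookup; replicate; removeAt)
open import Data.Vec.Properties using (lookup-replicate)
open import Data.List using (List; []; _∷_; _++_; map; filter; length; foldr; allFin)
open import Data.List.Properties using (filter-++; filter-all; filter-none; length-map; length-++; length-++-sucʳ; length-tabulate; map-tabulate; ++-identityʳ)
open import Data.List.Relation.Unary.All as All using (All; []; _∷_; all?)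
open import Data.List.Relation.Unary.All.Properties using (map⁺; map⁻; ++⁺; ++⁻)
open import Data.List.Relation.Binary.Permutation.Propositional using (_↭_; prep; ↭-sym)
open import Data.List.Relation.Binary.Permutation.Propositional.Properties using (All-resp-↭; ↭-length; shift)
import Data.List.Relation.Binary.Permutation.Propositional.Properties as ↭
open import Data.Fin using (Fin; punchIn; punchOut; _≟_)
open import Data.Fin.Properties using (any?; suc-injective; punchIn-injective; punchInᵢ≢i; punchIn-punchOut; punchOut-injective)
open import Data.Product using (∃; _×_; _,_)
open import Data.Sum using (_⊎_; inj₁; inj₂)
open import Data.Empty using (⊥-elim)
open import Function using (_∘_; _⇔_; mk⇔; Equivalence)
open import Relation.Binary.PropositionalEquality using (_≢_; refl; sym; trans; cong; cong₂; subst; subst₂; module ≡-Reasoning)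
open import Relation.Nullary using (Dec; yes; no; ¬_; ¬?)
open import Relation.Nullary.Decidable using (_×-dec_; _⊎-dec_)

private variable
  X Y : Set
  P Q : Set

-- A foldr, so that eulerChar Fs is definitionally ∑[ F ∈ Fs ] sign (length F ∸ 1).
∑ : List X → (X → ℤ) → ℤ
∑ xs f = foldr (λ x acc → f x + acc) (+ 0) xs

syntax ∑ xs (λ x → e) = ∑[ x ∈ xs ] e

∑-cong : (xs : List X) {f g : X → ℤ} → (∀ x → f x ≡ g x) → ∑ xs f ≡ ∑ xs g
∑-cong []       f≗g = refl
∑-cong (x ∷ xs) f≗g = cong₂ _+_ (f≗g x) (∑-cong xs f≗g)

∑-++ : (xs ys : List X) (f : X → ℤ) → ∑ (xs ++ ys) f ≡ ∑ xs f + ∑ ys f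
∑-++ []       ys f = sym (ℤ.+-identityˡ _)
∑-++ (x ∷ xs) ys f = trans (cong (_+_ (f x)) (∑-++ xs ys f)) (sym (ℤ.+-assoc (f x) _ _))

∑-map : (g : Y → X) (ys : List Y) (f : X → ℤ) → ∑ (map g ys) f ≡ ∑ ys (f ∘ g)
∑-map g []       f = refl
∑-map g (y ∷ ys) f = cong (_+_ (f (g y))) (∑-map g ys f)

∑-+ : (xs : List X) (f g : X → ℤ) → ∑[ x ∈ xs ] (f x + g x) ≡ ∑ xs f + ∑ xs g
∑-+ []       f g = refl
∑-+ (x ∷ xs) f g = trans (cong (_+_ (f x + g x)) (∑-+ xs f g)) (+-interchange (f x) (g x) _ _)
  where
  +-interchange : ∀ a b c d → (a + b) + (c + d) ≡ (a + c) + (b + d)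
  +-interchange = solve-∀

∑-neg : (xs : List X) (f : X → ℤ) → ∑[ x ∈ xs ] (- f x) ≡ - ∑ xs f
∑-neg []       f = refl
∑-neg (x ∷ xs) f = trans (cong (_+_ (- f x)) (∑-neg xs f)) (sym (ℤ.neg-distrib-+ (f x) _))

∑-*ʳ : (xs : List X) (f : X → ℤ) (c : ℤ) → ∑[ x ∈ xs ] (f x * c) ≡ ∑ xs f * c
∑-*ʳ []       f c = sym (ℤ.*-zeroˡ c)
∑-*ʳ (x ∷ xs) f c = trans (cong (_+_ (f x * c)) (∑-*ʳ xs f c)) (sym (ℤ.*-distribʳ-+ c (f x) _))

∑-const : (xs : List X) (c : ℤ) → ∑[ x ∈ xs ] c ≡ + length xs * c
∑-const []       c = sym (ℤ.*-zeroˡ c)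
∑-const (x ∷ xs) c = trans (cong (_+_ c) (∑-const xs c)) (sym (ℤ.suc-* (+ length xs) c))

∑-zero : (xs : List X) → ∑[ x ∈ xs ] (+ 0) ≡ + 0
∑-zero xs = trans (∑-const xs (+ 0)) (ℤ.*-zeroʳ (+ length xs))

∑-swap : (xs : List X) (ys : List Y) (f : X → Y → ℤ) →
  ∑[ x ∈ xs ] ∑[ y ∈ ys ] f x y ≡ ∑[ y ∈ ys ] ∑[ x ∈ xs ] f x y
∑-swap []       ys f = sym (∑-zero ys)
∑-swap (x ∷ xs) ys f = begin
    ∑ ys (f x) + ∑[ x′ ∈ xs ] ∑ ys (f x′)          ≡⟨ cong (_+_ (∑ ys (f x))) (∑-swap xs ys f) ⟩
    ∑ ys (f x) + ∑[ y ∈ ys ] ∑[ x′ ∈ xs ] f x′ y  ≡⟨ sym (∑-+ ys (f x) _) ⟩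
    ∑[ y ∈ ys ] (f x y + ∑[ x′ ∈ xs ] f x′ y)     ∎
  where open ≡-Reasoning

∑-allFin-suc : {n : ℕ} (f : Fin (suc n) → ℤ) →
  ∑ (allFin (suc n)) f ≡ f Fin.zero + ∑[ c ∈ allFin n ] f (Fin.suc c)
∑-allFin-suc {n} f = cong (_+_ (f Fin.zero))
  (trans (cong (λ cs → ∑ cs f) (sym (map-tabulate (λ c → c) Fin.suc))) (∑-map Fin.suc (allFin n) f))

𝟙 : Dec P → ℤ
𝟙 (yes _) = + 1
𝟙 (no _)  = + 0

𝟙-no : (p : Dec P) → ¬ P → 𝟙 p ≡ + 0
𝟙-no (yes p) ¬p = ⊥-elim (¬p p)
𝟙-no (no _)  ¬p = refl

𝟙-cong : P ⇔ Q → (p : Dec P) (q : Dec Q) → 𝟙 p ≡ 𝟙 q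
𝟙-cong P⇔Q (yes _) (yes _) = refl
𝟙-cong P⇔Q (no _)  (no _)  = refl
𝟙-cong P⇔Q (yes p) (no ¬q) = ⊥-elim (¬q (Equivalence.to P⇔Q p))
𝟙-cong P⇔Q (no ¬p) (yes q) = ⊥-elim (¬p (Equivalence.from P⇔Q q))

𝟙-¬ : (p : Dec P) → 𝟙 (¬? p) ≡ + 1 - 𝟙 p
𝟙-¬ (yes _) = refl
𝟙-¬ (no _)  = refl

𝟙-⊎ : ¬ (P × Q) → (p : Dec P) (q : Dec Q) → 𝟙 (p ⊎-dec q) ≡ 𝟙 p + 𝟙 q
𝟙-⊎ excl (yes p) (yes q) = ⊥-elim (excl (p , q))
𝟙-⊎ excl (yes _) (no _)  = refl
𝟙-⊎ excl (no _)  (yes _) = refl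
𝟙-⊎ excl (no _)  (no _)  = refl

𝟙-any : {n : ℕ} {P : Fin n → Set} (P? : ∀ c → Dec (P c)) → (∀ {c d} → P c → P d → c ≡ d) →
  𝟙 (any? P?) ≡ ∑[ c ∈ allFin n ] 𝟙 (P? c)
𝟙-any {zero}  P? unique = refl
𝟙-any {suc n} {P} P? unique = begin
    𝟙 (any? P?)
  ≡⟨ 𝟙-cong (mk⇔ split join) (any? P?) (P? Fin.zero ⊎-dec any? (P? ∘ Fin.suc)) ⟩
    𝟙 (P? Fin.zero ⊎-dec any? (P? ∘ Fin.suc))
  ≡⟨ 𝟙-⊎ (λ { (p , (c , q)) → zero≢suc (unique p q) }) (P? Fin.zero) (any? (P? ∘ Fin.suc)) ⟩
    𝟙 (P? Fin.zero) + 𝟙 (any? (P? ∘ Fin.suc))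
  ≡⟨ cong (_+_ (𝟙 (P? Fin.zero))) (𝟙-any (P? ∘ Fin.suc) (λ p q → suc-injective (unique p q))) ⟩
    𝟙 (P? Fin.zero) + ∑[ c ∈ allFin n ] 𝟙 (P? (Fin.suc c))
  ≡⟨ sym (∑-allFin-suc (λ c → 𝟙 (P? c))) ⟩
    ∑[ c ∈ allFin (suc n) ] 𝟙 (P? c)  ∎
  where
  open ≡-Reasoning
  split : ∃ P → P Fin.zero ⊎ ∃ (P ∘ Fin.suc)
  split (Fin.zero , p)  = inj₁ p
  split (Fin.suc c , p) = inj₂ (c , p)
  join : P Fin.zero ⊎ ∃ (P ∘ Fin.suc) → ∃ P
  join (inj₁ p)       = Fin.zero , p
  join (inj₂ (c , p)) = Fin.suc c , p
  zero≢suc : ∀ {c : Fin n} → Fin.zero ≢ Fin.suc c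
  zero≢suc ()

∑-filter : {P : X → Set} (P? : ∀ x → Dec (P x)) (xs : List X) (f : X → ℤ) →
  ∑ (filter P? xs) f ≡ ∑[ x ∈ xs ] (𝟙 (P? x) * f x)
∑-filter P? []       f = refl
∑-filter P? (x ∷ xs) f with P? x
... | yes _ = cong₂ _+_ (sym (ℤ.*-identityˡ (f x))) (∑-filter P? xs f)
... | no _  = trans (∑-filter P? xs f) (sym (ℤ.+-identityˡ _))

∑-sublists-∷ : (x : X) (xs : List X) (f : List X → ℤ) →
  ∑ (sublists (x ∷ xs)) f ≡ ∑ (sublists xs) f + ∑[ S ∈ sublists xs ] f (x ∷ S)
∑-sublists-∷ x xs f = trans (∑-++ (sublists xs) _ f) (cong (_+_ (∑ (sublists xs) f)) (∑-map (x ∷_) (sublists xs) f))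

∑-sublists-∷-vanishing : (x : X) (xs : List X) (f : List X → ℤ) → (∀ S → f (x ∷ S) ≡ + 0) →
  ∑ (sublists (x ∷ xs)) f ≡ ∑ (sublists xs) f
∑-sublists-∷-vanishing x xs f vanish = begin
  ∑ (sublists (x ∷ xs)) f                              ≡⟨ ∑-sublists-∷ x xs f ⟩
  ∑ (sublists xs) f + ∑[ S ∈ sublists xs ] f (x ∷ S)  ≡⟨ cong (_+_ (∑ (sublists xs) f)) (trans (∑-cong (sublists xs) vanish) (∑-zero (sublists xs))) ⟩
  ∑ (sublists xs) f + + 0                              ≡⟨ ℤ.+-identityʳ _ ⟩
  ∑ (sublists xs) f                                    ∎
  where open ≡-Reasoning

∑-sublists-map : (g : Y → X) (ys : List Y) (f : List X → ℤ) →
  ∑ (sublists (map g ys)) f ≡ ∑[ S ∈ sublists ys ] f (map g S)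
∑-sublists-map g []       f = refl
∑-sublists-map g (y ∷ ys) f = begin
    ∑ (sublists (g y ∷ map g ys)) f
  ≡⟨ ∑-sublists-∷ (g y) (map g ys) f ⟩
    ∑ (sublists (map g ys)) f + ∑[ S ∈ sublists (map g ys) ] f (g y ∷ S)
  ≡⟨ cong₂ _+_ (∑-sublists-map g ys f) (∑-sublists-map g ys (f ∘ (g y ∷_))) ⟩
    ∑[ S ∈ sublists ys ] f (map g S) + ∑[ S ∈ sublists ys ] f (g y ∷ map g S)
  ≡⟨ sym (∑-sublists-∷ y ys (f ∘ map g)) ⟩
    ∑[ S ∈ sublists (y ∷ ys) ] f (map g S)  ∎
  where open ≡-Reasoning

∑-sublists-++ : (xs ys : List X) (f : List X → ℤ) →
  ∑ (sublists (xs ++ ys)) f ≡ ∑[ S₁ ∈ sublists xs ] ∑[ S₂ ∈ sublists ys ] f (S₁ ++ S₂)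
∑-sublists-++ []       ys f = sym (ℤ.+-identityʳ _)
∑-sublists-++ (x ∷ xs) ys f = begin
    ∑ (sublists (x ∷ xs ++ ys)) f
  ≡⟨ ∑-sublists-∷ x (xs ++ ys) f ⟩
    ∑ (sublists (xs ++ ys)) f + ∑[ S ∈ sublists (xs ++ ys) ] f (x ∷ S)
  ≡⟨ cong₂ _+_ (∑-sublists-++ xs ys f) (∑-sublists-++ xs ys (f ∘ (x ∷_))) ⟩
    ∑[ S₁ ∈ sublists xs ] ∑[ S₂ ∈ sublists ys ] f (S₁ ++ S₂) + ∑[ S₁ ∈ sublists xs ] ∑[ S₂ ∈ sublists ys ] f (x ∷ S₁ ++ S₂)
  ≡⟨ sym (∑-sublists-∷ x xs (λ S₁ → ∑[ S₂ ∈ sublists ys ] f (S₁ ++ S₂))) ⟩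
    ∑[ S₁ ∈ sublists (x ∷ xs) ] ∑[ S₂ ∈ sublists ys ] f (S₁ ++ S₂)  ∎
  where open ≡-Reasoning

∑-sublists-sign : (x : X) (xs : List X) → ∑[ S ∈ sublists (x ∷ xs) ] sign (length S) ≡ + 0
∑-sublists-sign x xs = begin
    ∑[ S ∈ sublists (x ∷ xs) ] sign (length S)
  ≡⟨ ∑-sublists-∷ x xs (sign ∘ length) ⟩
    ∑[ S ∈ sublists xs ] sign (length S) + ∑[ S ∈ sublists xs ] (- sign (length S))
  ≡⟨ cong (_+_ (∑[ S ∈ sublists xs ] sign (length S))) (∑-neg (sublists xs) (sign ∘ length)) ⟩
    ∑[ S ∈ sublists xs ] sign (length S) - ∑[ S ∈ sublists xs ] sign (length S)
  ≡⟨ ℤ.+-inverseʳ (∑ (sublists xs) (sign ∘ length)) ⟩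
    + 0  ∎
  where open ≡-Reasoning

eulerChar-simplex : (xs : List X) → NonEmpty xs → eulerChar (filter nonEmpty? (sublists xs)) ≡ + 1
eulerChar-simplex []       nonEmpty = ⊥-elim (nonEmpty refl)
eulerChar-simplex (x ∷ xs) _        = trans (∑-filter nonEmpty? (sublists (x ∷ xs)) (λ F → sign (length F ∸ 1))) (alternating x xs)
  where
  alternating : (x : X) (xs : List X) →
    ∑[ F ∈ sublists (x ∷ xs) ] (𝟙 (nonEmpty? F) * sign (length F ∸ 1)) ≡ + 1
  alternating x []       = refl
  alternating x (y ∷ ys) = begin
      ∑[ F ∈ sublists (x ∷ y ∷ ys) ] (𝟙 (nonEmpty? F) * sign (length F ∸ 1))
    ≡⟨ ∑-sublists-∷ x (y ∷ ys) (λ F → 𝟙 (nonEmpty? F) * sign (length F ∸ 1)) ⟩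
      ∑[ F ∈ sublists (y ∷ ys) ] (𝟙 (nonEmpty? F) * sign (length F ∸ 1)) + ∑[ S ∈ sublists (y ∷ ys) ] (+ 1 * sign (length S))
    ≡⟨ cong₂ _+_ (alternating y ys) (trans (∑-cong (sublists (y ∷ ys)) (ℤ.*-identityˡ ∘ sign ∘ length)) (∑-sublists-sign y ys)) ⟩
      + 1  ∎
    where open ≡-Reasoning

module _ (colour : X → Bool) where

  Split : List X → List X → Set
  Split S₁ S₂ = All (λ x → colour x ≡ true) S₁ × All (λ x → colour x ≡ false) S₂

  split? : (S₁ S₂ : List X) → Dec (Split S₁ S₂)
  split? S₁ S₂ = all? (λ x → colour x Bool.≟ true) S₁ ×-dec all? (λ x → colour x Bool.≟ false) S₂

  splitSum : (List X → ℤ) → List X → ℤ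
  splitSum h xs = ∑[ S₁ ∈ sublists xs ] ∑[ S₂ ∈ sublists xs ] (𝟙 (split? S₁ S₂) * h (S₁ ++ S₂))

  splitSum-∷ : (h : List X → ℤ) → (∀ {S T} → S ↭ T → h S ≡ h T) → (x : X) (xs : List X) →
    splitSum h (x ∷ xs) ≡ splitSum h xs + splitSum (h ∘ (x ∷_)) xs
  splitSum-∷ h h-↭ x xs = peel (colour x) refl
    where
    open ≡-Reasoning
    inner : (List X → ℤ) → List X → ℤ
    inner g S₁ = ∑[ S₂ ∈ sublists xs ] (𝟙 (split? S₁ S₂) * g (S₁ ++ S₂))

    term : List X → List X → ℤ
    term S₁ S₂ = 𝟙 (split? S₁ S₂) * h (S₁ ++ S₂)

    split-∷ˡ : colour x ≡ true → ∀ S₁ S₂ → Split (x ∷ S₁) S₂ ⇔ Split S₁ S₂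
    split-∷ˡ cx S₁ S₂ = mk⇔ (λ { (_ ∷ s₁ , s₂) → s₁ , s₂ }) (λ (s₁ , s₂) → cx ∷ s₁ , s₂)

    split-∷ʳ : colour x ≡ false → ∀ S₁ S₂ → Split S₁ (x ∷ S₂) ⇔ Split S₁ S₂
    split-∷ʳ cx S₁ S₂ = mk⇔ (λ { (s₁ , _ ∷ s₂) → s₁ , s₂ }) (λ (s₁ , s₂) → s₁ , cx ∷ s₂)

    peel : (b : Bool) → colour x ≡ b → splitSum h (x ∷ xs) ≡ splitSum h xs + splitSum (h ∘ (x ∷_)) xs
    peel true cx = trans (∑-sublists-∷ x xs (λ S₁ → ∑ (sublists (x ∷ xs)) (term S₁))) (cong₂ _+_
      (∑-cong (sublists xs) (λ S₁ → ∑-sublists-∷-vanishing x xs (term S₁) (no-right S₁)))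
      (∑-cong (sublists xs) (λ S₁ → trans (∑-sublists-∷-vanishing x xs (term (x ∷ S₁)) (no-right (x ∷ S₁)))
        (∑-cong (sublists xs) (λ S₂ → cong (_* h (x ∷ S₁ ++ S₂))
          (𝟙-cong (split-∷ˡ cx S₁ S₂) (split? (x ∷ S₁) S₂) (split? S₁ S₂)))))))
      where
      no-right : ∀ S₁ S₂ → term S₁ (x ∷ S₂) ≡ + 0
      no-right S₁ S₂ = cong (_* h (S₁ ++ x ∷ S₂)) (𝟙-no (split? S₁ (x ∷ S₂)) λ { (_ , cx′ ∷ _) → Bool.not-¬ cx cx′ })
    peel false cx = begin
        splitSum h (x ∷ xs)
      ≡⟨ ∑-sublists-∷-vanishing x xs (λ S₁ → ∑ (sublists (x ∷ xs)) (term S₁))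
           (λ S₁ → trans (∑-cong (sublists (x ∷ xs)) (no-left S₁)) (∑-zero (sublists (x ∷ xs)))) ⟩
        ∑[ S₁ ∈ sublists xs ] ∑[ S₂ ∈ sublists (x ∷ xs) ] term S₁ S₂
      ≡⟨ ∑-cong (sublists xs) (λ S₁ → trans (∑-sublists-∷ x xs (term S₁)) (cong (_+_ (inner h S₁))
           (∑-cong (sublists xs) (λ S₂ → cong₂ _*_
             (𝟙-cong (split-∷ʳ cx S₁ S₂) (split? S₁ (x ∷ S₂)) (split? S₁ S₂)) (h-↭ (shift x S₁ S₂)))))) ⟩
        ∑[ S₁ ∈ sublists xs ] (inner h S₁ + inner (h ∘ (x ∷_)) S₁)
      ≡⟨ ∑-+ (sublists xs) (inner h) (inner (h ∘ (x ∷_))) ⟩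
        splitSum h xs + splitSum (h ∘ (x ∷_)) xs  ∎
      where
      no-left : ∀ S₁ S₂ → term (x ∷ S₁) S₂ ≡ + 0
      no-left S₁ S₂ = cong (_* h (x ∷ S₁ ++ S₂)) (𝟙-no (split? (x ∷ S₁) S₂) λ { (cx′ ∷ _ , _) → Bool.not-¬ cx cx′ })

  -- Splittings of T are pairs (T ∩ c⁻¹(true), T ∩ c⁻¹(false)), so they are in bijection with T.
  ∑-splittings : (h : List X → ℤ) → (∀ {S T} → S ↭ T → h S ≡ h T) → (xs : List X) →
    splitSum h xs ≡ ∑ (sublists xs) h
  ∑-splittings h h-↭ []       = cong (_+ + 0) (trans (ℤ.+-identityʳ _) (ℤ.*-identityˡ (h [])))
  ∑-splittings h h-↭ (x ∷ xs) = begin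
    splitSum h (x ∷ xs)                                ≡⟨ splitSum-∷ h h-↭ x xs ⟩
    splitSum h xs + splitSum (h ∘ (x ∷_)) xs           ≡⟨ cong₂ _+_ (∑-splittings h h-↭ xs) (∑-splittings (h ∘ (x ∷_)) (h-↭ ∘ prep x) xs) ⟩
    ∑ (sublists xs) h + ∑[ T ∈ sublists xs ] h (x ∷ T)  ≡⟨ ∑-sublists-∷ x xs h ⟨
    ∑ (sublists (x ∷ xs)) h                            ∎
    where open ≡-Reasoning

Agree : {n : ℕ} → List (Colouring n) → Fin n → Fin n → Set
Agree F a b = All (λ v → lookup v a ≡ lookup v b) F

agree? : {n : ℕ} (F : List (Colouring n)) (a b : Fin n) → Dec (Agree F a b)
agree? F a b = all? (λ v → lookup v a Bool.≟ lookup v b) F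

Separating : {n : ℕ} → List (Colouring n) → Set
Separating F = ¬ NonComplete F

separating? : {n : ℕ} (F : List (Colouring n)) → Dec (Separating F)
separating? F = ¬? (nonComplete? F)

𝟙-separating-cong : {n : ℕ} {F G : List (Colouring n)} → NonComplete F ⇔ NonComplete G →
  𝟙 (separating? F) ≡ 𝟙 (separating? G)
𝟙-separating-cong F⇔G = 𝟙-cong (mk⇔ (λ sep → sep ∘ Equivalence.from F⇔G) (λ sep → sep ∘ Equivalence.to F⇔G)) _ _

nonComplete-resp-↭ : {n : ℕ} {F G : List (Colouring n)} → F ↭ G → NonComplete F → NonComplete G
nonComplete-resp-↭ F↭G (a , b , a≢b , agree) = a , b , a≢b , All-resp-↭ F↭G agree

nonComplete-replicate-∷ : {n : ℕ} (x : Bool) (F : List (Colouring n)) →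
  NonComplete (replicate n x ∷ F) ⇔ NonComplete F
nonComplete-replicate-∷ x F = mk⇔
  (λ { (a , b , a≢b , _ ∷ agree) → a , b , a≢b , agree })
  (λ (a , b , a≢b , agree) → a , b , a≢b , trans (lookup-replicate a x) (sym (lookup-replicate b x)) ∷ agree)

removeAt-punchIn : {A : Set} {n : ℕ} (v : Vec A (suc n)) (p : Fin (suc n)) (c : Fin n) →
  lookup (removeAt v p) c ≡ lookup v (punchIn p c)
removeAt-punchIn (x ∷ v)     Fin.zero    c           = refl
removeAt-punchIn (x ∷ y ∷ v) (Fin.suc p) Fin.zero    = refl
removeAt-punchIn (x ∷ y ∷ v) (Fin.suc p) (Fin.suc c) = removeAt-punchIn (y ∷ v) p c

module _ {n : ℕ} (p : Fin (suc n)) (F : List (Colouring (suc n))) where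

  private
    F∖p : List (Colouring n)
    F∖p = map (λ v → removeAt v p) F

  agree-removeAt : ∀ {a b} → Agree F∖p a b ⇔ Agree F (punchIn p a) (punchIn p b)
  agree-removeAt {a} {b} = mk⇔
    (λ agree → All.map (λ {v} e → trans (sym (removeAt-punchIn v p a)) (trans e (removeAt-punchIn v p b))) (map⁻ agree))
    (λ agree → map⁺ (All.map (λ {v} e → trans (removeAt-punchIn v p a) (trans e (sym (removeAt-punchIn v p b)))) agree))

  nonComplete-removeAt : NonComplete F ⇔ (NonComplete F∖p ⊎ ∃ λ c → Agree F p (punchIn p c))
  nonComplete-removeAt = mk⇔ to from
    where
    to : NonComplete F → NonComplete F∖p ⊎ ∃ λ c → Agree F p (punchIn p c)
    to (a , b , a≢b , agree) with a ≟ p | b ≟ p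
    ... | yes refl | _        = inj₂ (punchOut a≢b , subst (Agree F a) (sym (punchIn-punchOut a≢b)) agree)
    ... | no a≢p   | yes refl = inj₂ (punchOut (a≢p ∘ sym) ,
                                      subst (Agree F b) (sym (punchIn-punchOut (a≢p ∘ sym))) (All.map sym agree))
    ... | no a≢p   | no b≢p   = inj₁ (punchOut (a≢p ∘ sym) , punchOut (b≢p ∘ sym) ,
                                      a≢b ∘ punchOut-injective (a≢p ∘ sym) (b≢p ∘ sym) ,
                                      Equivalence.from agree-removeAt
                                        (subst₂ (Agree F) (sym (punchIn-punchOut (a≢p ∘ sym))) (sym (punchIn-punchOut (b≢p ∘ sym))) agree))
    from : NonComplete F∖p ⊎ ∃ (λ c → Agree F p (punchIn p c)) → NonComplete F
    from (inj₁ (a , b , a≢b , agree)) =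
      punchIn p a , punchIn p b , a≢b ∘ punchIn-injective p a b , Equivalence.to agree-removeAt agree
    from (inj₂ (c , agree)) = p , punchIn p c , punchInᵢ≢i p c ∘ sym , agree

  agree-punchIn-unique : Separating F∖p → ∀ {c d} → Agree F p (punchIn p c) → Agree F p (punchIn p d) → c ≡ d
  agree-punchIn-unique sep {c} {d} agree-c agree-d with c ≟ d
  ... | yes c≡d = c≡d
  ... | no c≢d  = ⊥-elim (sep (c , d , c≢d , Equivalence.from agree-removeAt
                    (All.zipWith (λ (e , e′) → trans (sym e) e′) (agree-c , agree-d))))

  𝟙-separating-removeAt :
    𝟙 (separating? F) ≡ 𝟙 (separating? F∖p) * (+ 1 - ∑[ c ∈ allFin n ] 𝟙 (agree? F p (punchIn p c)))
  𝟙-separating-removeAt with nonComplete? F∖p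
  ... | yes nc = 𝟙-no (separating? F) (λ sep → sep (Equivalence.from nonComplete-removeAt (inj₁ nc)))
  ... | no sep = begin
      𝟙 (separating? F)
    ≡⟨ 𝟙-¬ (nonComplete? F) ⟩
      + 1 - 𝟙 (nonComplete? F)
    ≡⟨ cong (λ z → + 1 - z) (𝟙-cong nc⇔∃ (nonComplete? F) (any? λ c → agree? F p (punchIn p c))) ⟩
      + 1 - 𝟙 (any? λ c → agree? F p (punchIn p c))
    ≡⟨ cong (λ z → + 1 - z) (𝟙-any (λ c → agree? F p (punchIn p c)) (agree-punchIn-unique sep)) ⟩
      + 1 - ∑[ c ∈ allFin n ] 𝟙 (agree? F p (punchIn p c))
    ≡⟨ sym (ℤ.*-identityˡ _) ⟩
      + 1 * (+ 1 - ∑[ c ∈ allFin n ] 𝟙 (agree? F p (punchIn p c)))  ∎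
    where
    open ≡-Reasoning
    nc⇔∃ : NonComplete F ⇔ ∃ λ c → Agree F p (punchIn p c)
    nc⇔∃ = mk⇔ (λ nc → case-removeAt (Equivalence.to nonComplete-removeAt nc))
               (Equivalence.from nonComplete-removeAt ∘ inj₂)
      where
      case-removeAt : NonComplete F∖p ⊎ ∃ (λ c → Agree F p (punchIn p c)) → ∃ λ c → Agree F p (punchIn p c)
      case-removeAt (inj₁ nc) = ⊥-elim (sep nc)
      case-removeAt (inj₂ ∃c) = ∃c

prepend : {k : ℕ} → Bool → List (Vec Bool k) → List (Vec Bool (suc k))
prepend b = map (b ∷_)

notAllTrue : (k : ℕ) → List (Colouring k)
notAllTrue k = filter (λ v → someFalse v Bool.≟ true) (colourings k)

filter-map : {P : X → Set} (P? : ∀ x → Dec (P x)) (f : Y → X) (ys : List Y) →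
  filter P? (map f ys) ≡ map f (filter (P? ∘ f) ys)
filter-map P? f []       = refl
filter-map P? f (y ∷ ys) with P? (f y)
... | yes _ = cong (f y ∷_) (filter-map P? f ys)
... | no _  = filter-map P? f ys

notAllTrue-suc : (k : ℕ) → notAllTrue (suc k) ≡ prepend true (notAllTrue k) ++ prepend false (colourings k)
notAllTrue-suc k = trans (filter-++ someFalse? (prepend true (colourings k)) (prepend false (colourings k)))
  (cong₂ _++_ (filter-map someFalse? (true ∷_) (colourings k))
              (filter-all someFalse? (map⁺ (All.universal (λ _ → refl) (colourings k)))))
  where
  someFalse? : {n : ℕ} (v : Colouring n) → Dec (someFalse v ≡ true)
  someFalse? v = someFalse v Bool.≟ true

colourings-split : (k : ℕ) → colourings k ≡ replicate k true ∷ notAllTrue k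
colourings-split zero    = refl
colourings-split (suc k) = begin
    prepend true (colourings k) ++ prepend false (colourings k)
  ≡⟨ cong (λ C → prepend true C ++ prepend false (colourings k)) (colourings-split k) ⟩
    replicate (suc k) true ∷ prepend true (notAllTrue k) ++ prepend false (colourings k)
  ≡⟨ cong (replicate (suc k) true ∷_) (sym (notAllTrue-suc k)) ⟩
    replicate (suc k) true ∷ notAllTrue (suc k)  ∎
  where open ≡-Reasoning

notAllTrue-suc-allTrue : (k : ℕ) →
  notAllTrue (suc k) ≡ prepend true (notAllTrue k) ++ prepend false (replicate k true ∷ notAllTrue k)
notAllTrue-suc-allTrue k =
  trans (notAllTrue-suc k) (cong (λ C → prepend true (notAllTrue k) ++ prepend false C) (colourings-split k))

vertices-suc : (k : ℕ) → vertices (suc k) ≡ prepend true (notAllTrue k)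
vertices-suc k = begin
    filter isVertex? (prepend true (colourings k) ++ prepend false (colourings k))
  ≡⟨ filter-++ isVertex? (prepend true (colourings k)) (prepend false (colourings k)) ⟩
    filter isVertex? (prepend true (colourings k)) ++ filter isVertex? (prepend false (colourings k))
  ≡⟨ cong₂ _++_ (filter-map isVertex? (true ∷_) (colourings k))
                (filter-none isVertex? (map⁺ (All.universal (λ _ ()) (colourings k)))) ⟩
    prepend true (notAllTrue k) ++ []
  ≡⟨ ++-identityʳ _ ⟩
    prepend true (notAllTrue k)  ∎
  where
  open ≡-Reasoning
  isVertex? : {n : ℕ} (v : Colouring n) → Dec (isVertex v ≡ true)
  isVertex? v = isVertex v Bool.≟ true

vertices-nonEmpty : (m : ℕ) → NonEmpty (vertices (suc (suc m)))
vertices-nonEmpty m = subst NonEmpty (sym vertices≡) (middle-nonEmpty (prepend true (notAllTrue m)) _ _)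
  where
  vertices≡ : vertices (suc (suc m)) ≡
    prepend true (prepend true (notAllTrue m) ++ (false ∷ replicate m true) ∷ prepend false (notAllTrue m))
  vertices≡ = trans (vertices-suc (suc m)) (cong (prepend true) (notAllTrue-suc-allTrue m))
  middle-nonEmpty : (xs : List (Colouring (suc m))) (x : Colouring (suc m)) (ys : List (Colouring (suc m))) →
    NonEmpty (prepend true (xs ++ x ∷ ys))
  middle-nonEmpty []      x ys = λ ()
  middle-nonEmpty (_ ∷ _) x ys = λ ()

module _ {k : ℕ} where

  colourAt : Fin (suc k) → Vec Bool k → Bool
  colourAt c w = lookup (true ∷ w) c

  lookup-punchIn-1 : {A : Set} (x y : A) (w : Vec A k) (c : Fin (suc k)) →
    lookup (x ∷ y ∷ w) (punchIn (Fin.suc Fin.zero) c) ≡ lookup (x ∷ w) c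
  lookup-punchIn-1 x y w Fin.zero    = refl
  lookup-punchIn-1 x y w (Fin.suc c) = refl

  removeAt-1-prepend : (S₁ S₂ : List (Vec Bool k)) →
    map (λ v → removeAt v (Fin.suc Fin.zero)) (prepend true (prepend true S₁ ++ prepend false S₂)) ≡ prepend true (S₁ ++ S₂)
  removeAt-1-prepend []       []       = refl
  removeAt-1-prepend []       (w ∷ S₂) = cong ((true ∷ w) ∷_) (removeAt-1-prepend [] S₂)
  removeAt-1-prepend (w ∷ S₁) S₂       = cong ((true ∷ w) ∷_) (removeAt-1-prepend S₁ S₂)

  agree-1-prepend : (S₁ S₂ : List (Vec Bool k)) (c : Fin (suc k)) →
    Agree (prepend true (prepend true S₁ ++ prepend false S₂)) (Fin.suc Fin.zero) (punchIn (Fin.suc Fin.zero) c)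
      ⇔ Split (colourAt c) S₁ S₂
  agree-1-prepend S₁ S₂ c = mk⇔
    (λ agree → let (agree₁ , agree₂) = ++⁻ (prepend true S₁) (map⁻ agree) in
      All.map (λ {w} e → sym (trans e (lookup-punchIn-1 true true w c))) (map⁻ agree₁) ,
      All.map (λ {w} e → sym (trans e (lookup-punchIn-1 true false w c))) (map⁻ agree₂))
    (λ (split₁ , split₂) → map⁺ (++⁺
      (map⁺ (All.map (λ {w} e → sym (trans (lookup-punchIn-1 true true w c) e)) split₁))
      (map⁺ (All.map (λ {w} e → sym (trans (lookup-punchIn-1 true false w c) e)) split₂))))

  𝟙-separating-prepend : (S₁ S₂ : List (Vec Bool k)) →
    𝟙 (separating? (prepend true (prepend true S₁ ++ prepend false S₂)))
      ≡ 𝟙 (separating? (prepend true (S₁ ++ S₂))) * (+ 1 - ∑[ c ∈ allFin (suc k) ] 𝟙 (split? (colourAt c) S₁ S₂))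
  𝟙-separating-prepend S₁ S₂ = trans (𝟙-separating-removeAt (Fin.suc Fin.zero) F)
    (cong₂ (λ G n → 𝟙 (separating? G) * (+ 1 - n)) (removeAt-1-prepend S₁ S₂)
      (∑-cong (allFin (suc k)) λ c → 𝟙-cong (agree-1-prepend S₁ S₂ c)
        (agree? F (Fin.suc Fin.zero) (punchIn (Fin.suc Fin.zero) c)) (split? (colourAt c) S₁ S₂)))
    where
    F : List (Colouring (suc (suc k)))
    F = prepend true (prepend true S₁ ++ prepend false S₂)

separatingWeight : {k : ℕ} → List (Vec Bool k) → ℤ
separatingWeight T = 𝟙 (separating? (prepend true T)) * sign (length T)

separatingWeight-resp-↭ : {k : ℕ} {S T : List (Vec Bool k)} → S ↭ T → separatingWeight S ≡ separatingWeight T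
separatingWeight-resp-↭ S↭T = cong₂ _*_
  (𝟙-separating-cong (mk⇔ (nonComplete-resp-↭ (↭.map⁺ (true ∷_) S↭T)) (nonComplete-resp-↭ (↭.map⁺ (true ∷_) (↭-sym S↭T)))))
  (cong sign (↭-length S↭T))

length-prepend-++ : {k : ℕ} (S₁ S₂ : List (Vec Bool k)) → length (prepend true S₁ ++ prepend false S₂) ≡ length (S₁ ++ S₂)
length-prepend-++ S₁ S₂ = begin
  length (prepend true S₁ ++ prepend false S₂)            ≡⟨ length-++ (prepend true S₁) ⟩
  length (prepend true S₁) ℕ.+ length (prepend false S₂)  ≡⟨ cong₂ ℕ._+_ (length-map (true ∷_) S₁) (length-map (false ∷_) S₂) ⟩
  length S₁ ℕ.+ length S₂                                 ≡⟨ length-++ S₁ ⟨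
  length (S₁ ++ S₂)                                       ∎
  where open ≡-Reasoning

-- Adding the all-true colouring to S₂ changes no separation, but flips the sign.
separatingWeight-prepend-pair : {k : ℕ} (S₁ S₂ : List (Vec Bool k)) →
  separatingWeight (prepend true S₁ ++ prepend false S₂)
    + separatingWeight (prepend true S₁ ++ prepend false (replicate k true ∷ S₂))
    ≡ - ∑[ c ∈ allFin (suc k) ] (𝟙 (split? (colourAt c) S₁ S₂) * separatingWeight (S₁ ++ S₂))
separatingWeight-prepend-pair {k} S₁ S₂ = begin
    separatingWeight (prepend true S₁ ++ prepend false S₂)
      + separatingWeight (prepend true S₁ ++ prepend false (allTrue ∷ S₂))
  ≡⟨ cong₂ _+_ (cong₂ _*_ (𝟙-separating-prepend S₁ S₂) (cong sign (length-prepend-++ S₁ S₂)))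
               (cong₂ _*_ (trans (𝟙-separating-prepend S₁ (allTrue ∷ S₂)) (cong₂ (λ a′ n′ → a′ * (+ 1 - n′)) drop-allTrue no-split))
                          (cong sign (trans (length-prepend-++ S₁ (allTrue ∷ S₂)) (length-++-sucʳ S₁ allTrue S₂)))) ⟩
    a * (+ 1 - n) * s + a * (+ 1 - + 0) * (- s)
  ≡⟨ cancel a n s ⟩
    - (n * (a * s))
  ≡⟨ cong -_ (∑-*ʳ (allFin (suc k)) (λ c → 𝟙 (split? (colourAt c) S₁ S₂)) (a * s)) ⟨
    - ∑[ c ∈ allFin (suc k) ] (𝟙 (split? (colourAt c) S₁ S₂) * (a * s))  ∎
  where
  open ≡-Reasoning
  allTrue : Vec Bool k
  allTrue = replicate k true
  a s n : ℤ
  a = 𝟙 (separating? (prepend true (S₁ ++ S₂)))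
  s = sign (length (S₁ ++ S₂))
  n = ∑[ c ∈ allFin (suc k) ] 𝟙 (split? (colourAt c) S₁ S₂)

  cancel : ∀ a n s → a * (+ 1 - n) * s + a * (+ 1 - + 0) * (- s) ≡ - (n * (a * s))
  cancel = solve-∀

  drop-allTrue : 𝟙 (separating? (prepend true (S₁ ++ allTrue ∷ S₂))) ≡ a
  drop-allTrue = 𝟙-separating-cong (mk⇔
    (Equivalence.to (nonComplete-replicate-∷ true _) ∘ nonComplete-resp-↭ (↭.map⁺ (true ∷_) (shift allTrue S₁ S₂)))
    (nonComplete-resp-↭ (↭.map⁺ (true ∷_) (↭-sym (shift allTrue S₁ S₂))) ∘ Equivalence.from (nonComplete-replicate-∷ true _)))

  no-split : ∑[ c ∈ allFin (suc k) ] 𝟙 (split? (colourAt c) S₁ (allTrue ∷ S₂)) ≡ + 0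
  no-split = trans (∑-cong (allFin (suc k)) λ c → 𝟙-no (split? (colourAt c) S₁ (allTrue ∷ S₂))
                     λ { (_ , c-false ∷ _) → Bool.not-¬ (lookup-replicate c true) c-false })
                   (∑-zero (allFin (suc k)))

separatingSum : ℕ → ℤ
separatingSum k = ∑ (sublists (notAllTrue k)) separatingWeight

separatingSum-suc : (k : ℕ) → separatingSum (suc k) ≡ - (+ suc k * separatingSum k)
separatingSum-suc k = begin
    ∑ (sublists (notAllTrue (suc k))) separatingWeight
  ≡⟨ cong (λ L → ∑ (sublists L) separatingWeight) (notAllTrue-suc-allTrue k) ⟩
    ∑ (sublists (prepend true W ++ prepend false (allTrue ∷ W))) separatingWeight
  ≡⟨ ∑-sublists-++ (prepend true W) (prepend false (allTrue ∷ W)) separatingWeight ⟩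
    ∑[ A ∈ sublists (prepend true W) ] ∑[ B ∈ sublists (prepend false (allTrue ∷ W)) ] separatingWeight (A ++ B)
  ≡⟨ ∑-sublists-map (true ∷_) W (λ A → ∑[ B ∈ sublists (prepend false (allTrue ∷ W)) ] separatingWeight (A ++ B)) ⟩
    ∑[ S₁ ∈ sublists W ] ∑[ B ∈ sublists (prepend false (allTrue ∷ W)) ] separatingWeight (prepend true S₁ ++ B)
  ≡⟨ ∑-cong (sublists W) (λ S₁ → ∑-sublists-map (false ∷_) (allTrue ∷ W) (λ B → separatingWeight (prepend true S₁ ++ B))) ⟩
    ∑[ S₁ ∈ sublists W ] ∑[ S₂ ∈ sublists (allTrue ∷ W) ] weight S₁ S₂
  ≡⟨ ∑-cong (sublists W) (λ S₁ → trans (∑-sublists-∷ allTrue W (weight S₁)) (sym (∑-+ (sublists W) (weight S₁) (weight S₁ ∘ (allTrue ∷_))))) ⟩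
    ∑[ S₁ ∈ sublists W ] ∑[ S₂ ∈ sublists W ] (weight S₁ S₂ + weight S₁ (allTrue ∷ S₂))
  ≡⟨ ∑-cong (sublists W) (λ S₁ → ∑-cong (sublists W) (separatingWeight-prepend-pair S₁)) ⟩
    ∑[ S₁ ∈ sublists W ] ∑[ S₂ ∈ sublists W ] (- ∑[ c ∈ allFin (suc k) ] splitWeight c S₁ S₂)
  ≡⟨ ∑-cong (sublists W) (λ S₁ → trans (∑-neg (sublists W) (λ S₂ → ∑[ c ∈ allFin (suc k) ] splitWeight c S₁ S₂))
                                       (cong -_ (∑-swap (sublists W) (allFin (suc k)) (λ S₂ c → splitWeight c S₁ S₂)))) ⟩
    ∑[ S₁ ∈ sublists W ] (- ∑[ c ∈ allFin (suc k) ] ∑[ S₂ ∈ sublists W ] splitWeight c S₁ S₂)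
  ≡⟨ trans (∑-neg (sublists W) (λ S₁ → ∑[ c ∈ allFin (suc k) ] ∑[ S₂ ∈ sublists W ] splitWeight c S₁ S₂))
           (cong -_ (∑-swap (sublists W) (allFin (suc k)) (λ S₁ c → ∑[ S₂ ∈ sublists W ] splitWeight c S₁ S₂))) ⟩
    - ∑[ c ∈ allFin (suc k) ] ∑[ S₁ ∈ sublists W ] ∑[ S₂ ∈ sublists W ] splitWeight c S₁ S₂
  ≡⟨ cong -_ (∑-cong (allFin (suc k)) λ c → ∑-splittings (colourAt c) separatingWeight separatingWeight-resp-↭ W) ⟩
    - ∑[ c ∈ allFin (suc k) ] separatingSum k
  ≡⟨ cong -_ (trans (∑-const (allFin (suc k)) (separatingSum k)) (cong (λ n → + n * separatingSum k) (length-tabulate {n = suc k} (λ c → c)))) ⟩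
    - (+ suc k * separatingSum k)  ∎
  where
  open ≡-Reasoning
  W : List (Vec Bool k)
  W = notAllTrue k
  allTrue : Vec Bool k
  allTrue = replicate k true
  weight : List (Vec Bool k) → List (Vec Bool k) → ℤ
  weight S₁ S₂ = separatingWeight (prepend true S₁ ++ prepend false S₂)
  splitWeight : Fin (suc k) → List (Vec Bool k) → List (Vec Bool k) → ℤ
  splitWeight c S₁ S₂ = 𝟙 (split? (colourAt c) S₁ S₂) * separatingWeight (S₁ ++ S₂)

separatingSum-closed : (k : ℕ) → separatingSum k ≡ sign k * + (k !)
separatingSum-closed zero    = refl
separatingSum-closed (suc k) = begin
    separatingSum (suc k)                ≡⟨ separatingSum-suc k ⟩
    - (+ suc k * separatingSum k)        ≡⟨ cong (λ z → - (+ suc k * z)) (separatingSum-closed k) ⟩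
    - (+ suc k * (sign k * + (k !)))     ≡⟨ rearrange (+ suc k) (sign k) (+ (k !)) ⟩
    - sign k * (+ suc k * + (k !))       ≡⟨ cong (- sign k *_) (ℤ.pos-* (suc k) (k !)) ⟨
    sign (suc k) * + (suc k !)           ∎
  where
  open ≡-Reasoning
  rearrange : ∀ n s f → - (n * (s * f)) ≡ - s * (n * f)
  rearrange = solve-∀

∑-faces-separating : (m : ℕ) →
  ∑[ F ∈ faces (suc (suc m)) ] (𝟙 (separating? F) * sign (length F ∸ 1)) ≡ - separatingSum (suc m)
∑-faces-separating m = begin
    ∑[ F ∈ faces n ] (𝟙 (separating? F) * sign (length F ∸ 1))
  ≡⟨ ∑-filter nonEmpty? (sublists (vertices n)) (λ F → 𝟙 (separating? F) * sign (length F ∸ 1)) ⟩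
    ∑[ F ∈ sublists (vertices n) ] (𝟙 (nonEmpty? F) * (𝟙 (separating? F) * sign (length F ∸ 1)))
  ≡⟨ ∑-cong (sublists (vertices n)) shift-sign ⟩
    ∑[ F ∈ sublists (vertices n) ] (- (𝟙 (separating? F) * sign (length F)))
  ≡⟨ ∑-neg (sublists (vertices n)) (λ F → 𝟙 (separating? F) * sign (length F)) ⟩
    - ∑[ F ∈ sublists (vertices n) ] (𝟙 (separating? F) * sign (length F))
  ≡⟨ cong (λ V → - ∑[ F ∈ sublists V ] (𝟙 (separating? F) * sign (length F))) (vertices-suc (suc m)) ⟩
    - ∑[ F ∈ sublists (prepend true (notAllTrue (suc m))) ] (𝟙 (separating? F) * sign (length F))
  ≡⟨ cong -_ (∑-sublists-map (true ∷_) (notAllTrue (suc m)) (λ F → 𝟙 (separating? F) * sign (length F))) ⟩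
    - ∑[ T ∈ sublists (notAllTrue (suc m)) ] (𝟙 (separating? (prepend true T)) * sign (length (prepend true T)))
  ≡⟨ cong -_ (∑-cong (sublists (notAllTrue (suc m))) λ T →
       cong (λ l → 𝟙 (separating? (prepend true T)) * sign l) (length-map (true ∷_) T)) ⟩
    - separatingSum (suc m)  ∎
  where
  open ≡-Reasoning
  n : ℕ
  n = suc (suc m)
  -- The empty face is not separating, as there are two points.
  shift-sign : (F : List (Colouring n)) →
    𝟙 (nonEmpty? F) * (𝟙 (separating? F) * sign (length F ∸ 1)) ≡ - (𝟙 (separating? F) * sign (length F))
  shift-sign []      = sym (cong (λ z → - (z * + 1))
    (𝟙-no (separating? {n} []) λ sep → sep (Fin.zero , Fin.suc Fin.zero , (λ ()) , [])))
  shift-sign (v ∷ F) = flip (𝟙 (separating? (v ∷ F))) (sign (length F))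
    where
    flip : ∀ a s → + 1 * (a * s) ≡ - (a * - s)
    flip = solve-∀

𝟙-complement : (p : Dec P) (z : ℤ) → 𝟙 p * z ≡ z - 𝟙 (¬? p) * z
𝟙-complement p z = trans (complement (𝟙 p) z) (cong (λ b → z - b * z) (sym (𝟙-¬ p)))
  where
  complement : ∀ b z → b * z ≡ z - (+ 1 - b) * z
  complement = solve-∀

eulerChar-Ω : (m : ℕ) → eulerChar (Ω (suc (suc m))) ≡ + 1 + separatingSum (suc m)
eulerChar-Ω m = begin
    eulerChar (filter nonComplete? (faces n))
  ≡⟨ ∑-filter nonComplete? (faces n) e ⟩
    ∑[ F ∈ faces n ] (𝟙 (nonComplete? F) * e F)
  ≡⟨ ∑-cong (faces n) (λ F → 𝟙-complement (nonComplete? F) (e F)) ⟩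
    ∑[ F ∈ faces n ] (e F - 𝟙 (separating? F) * e F)
  ≡⟨ ∑-+ (faces n) e (λ F → - (𝟙 (separating? F) * e F)) ⟩
    eulerChar (faces n) + ∑[ F ∈ faces n ] (- (𝟙 (separating? F) * e F))
  ≡⟨ cong (_+_ (eulerChar (faces n))) (∑-neg (faces n) (λ F → 𝟙 (separating? F) * e F)) ⟩
    eulerChar (faces n) - ∑[ F ∈ faces n ] (𝟙 (separating? F) * e F)
  ≡⟨ cong₂ _-_ (eulerChar-simplex (vertices n) (vertices-nonEmpty m)) (∑-faces-separating m) ⟩
    + 1 - - separatingSum (suc m)
  ≡⟨ cong (_+_ (+ 1)) (ℤ.neg-involutive (separatingSum (suc m))) ⟩
    + 1 + separatingSum (suc m)  ∎
  where
  open ≡-Reasoning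
  n : ℕ
  n = suc (suc m)
  e : List (Colouring n) → ℤ
  e F = sign (length F ∸ 1)

lemma3 : (k : ℕ) → 2 ≤ k →
    eulerChar (Ω k) ≡ + 1 - sign k * + ((k ∸ 1) !)
lemma3 (suc (suc m)) (s≤s (s≤s z≤n)) = begin
    eulerChar (Ω (suc (suc m)))         ≡⟨ eulerChar-Ω m ⟩
    + 1 + separatingSum (suc m)         ≡⟨ cong (_+_ (+ 1)) (separatingSum-closed (suc m)) ⟩
    + 1 + sign (suc m) * + (suc m !)    ≡⟨ negate (sign (suc m)) (+ (suc m !)) ⟩
    + 1 - sign (suc (suc m)) * + (suc m !)  ∎
  where
  open ≡-Reasoning
  negate : ∀ s f → + 1 + s * f ≡ + 1 - (- s) * f
  negate = solve-∀
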